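{- Let $\mathcal{G}$ be an additive abelian group of order $n\ge2$, $m\ge 2$, and let $A_1,\dots,A_m$ be pairwise disjoint $k$-subsets of $\mathcal{G}$. The $k$-regular weak AMD code with sources $s_1,\dots,s_m$ and $A(s_i)=A_i$ is simultaneously R-optimal and G-optimal, i.e. $\hat\epsilon=\frac{k(m-1)}{n-1}=\frac{1}{km}$, if and only if $A_1,\dots,A_m$ is an $(n,m,k,1)$-external difference family.
   Context: For disjoint subsets $A,B$ of $\mathcal{G}$, $\mathcal{D}(A,B)$ denotes the multiset $\{x-y : x\in A, y\in B\}$. An $(n,m,k,\lambda)$-external difference family (EDF) is a collection of $m$ pairwise disjoint $k$-subsets $A_1,\dots,A_m$ of $\mathcal{G}$ with $\bigcup_{i\ne j}\mathcal{D}(A_i,A_j)=\lambda(\mathcal{G}\setminus\{0\})$ as multisets. A $k$-regular AMD code with source set $\mathcal{S}$ consists of pairwise disjoint $k$-subsets $A(s)\subseteq\mathcal{G}$ and an encoding $E$ with $E(s)$ uniform on $A(s)$. Weak security game: the adversary chooses $\Delta\in\mathcal{G}\setminus\{0\}$ by a (possibly randomized) strategy; then $s$ is chosen uniformly from $\mathcal{S}$ and encoded as $g=E(s)$; the adversary wins iff $g+\Delta\in A(s')$ for some $s'\ne s$. $\hat\epsilon$ is the maximum winning probability over all strategies. With $a$ the total number of valid encodings ($a=km$ here), the code is R-optimal if $\hat\epsilon=a(m-1)/(m(n-1))$ and G-optimal if $\hat\epsilon=1/a$.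
   Formalization: The adversary's randomized strategies, over which $\hat\epsilon$ is the maximum winning probability, range only over probability distributions on $\mathcal{G}\setminus\{0\}$ with rational values. -}

module Defs where

open import Level using (0ℓ)
open import Data.Nat as ℕ using (ℕ; zero; suc; _∸_)
open import Data.Fin as Fin using (Fin)
open import Data.Fin.Properties as FinP using ()
open import Data.List using (List; []; _∷_; length; filter; map; concat; concatMap; foldr)
open import Data.List.Membership.Propositional using (_∈_; _∉_)
open import Data.List.Relation.Unary.Unique.Propositional using (Unique)
import Data.List
import Data.Bool
import Data.Bool.ListAction
import Data.Nat.ListAction
open import Data.Integer using (+_)
open import Data.Rational as ℚ using (ℚ; 0ℚ; 1ℚ)
open import Data.Product using (_×_; _,_; ∃-syntax)
open import Data.Bool using (Bool; true; false; if_then_else_)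
open import Relation.Nullary using (¬_; Dec; yes; no)
open import Relation.Nullary.Decidable using (map′; ⌊_⌋)
open import Relation.Binary.PropositionalEquality using (_≡_; _≢_; cong)
open import Algebra.Structures using (IsAbelianGroup)
open import Function.Bundles using (_↔_; Inverse)

record FinAbGroup (n : ℕ) : Set₁ where
  infixl 6 _+_ _-_
  field
    Carrier        : Set
    _+_            : Carrier → Carrier → Carrier
    0#             : Carrier
    -_             : Carrier → Carrier
    isAbelianGroup : IsAbelianGroup _≡_ _+_ 0# -_
    enum           : Fin n ↔ Carrier

  _-_ : Carrier → Carrier → Carrier
  x - y = x + (- y)

  elements : List Carrier
  elements = map (Inverse.to enum) (Data.List.allFin n)

  _≟_ : (x y : Carrier) → Dec (x ≡ y)
  x ≟ y = map′ inj (cong (Inverse.from enum))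
               (Inverse.from enum x FinP.≟ Inverse.from enum y)
    where
    open Relation.Binary.PropositionalEquality using (trans; sym)
    inj : Inverse.from enum x ≡ Inverse.from enum y → x ≡ y
    inj e = trans (sym (Inverse.strictlyInverseˡ enum x))
                  (trans (cong (Inverse.to enum) e)
                         (Inverse.strictlyInverseˡ enum y))

count : {A : Set} → (A → Bool) → List A → ℕ
count p xs = length (filter (λ x → Relation.Nullary.Decidable.T? (p x)) xs)
  where open import Data.Bool using (T)

sumℚ : {A : Set} → (A → ℚ) → List A → ℚ
sumℚ f = foldr (λ x acc → f x ℚ.+ acc) 0ℚ

-- a / b as a rational (convention: a / 0 = 0; only used with b ≠ 0)
frac : ℕ → ℕ → ℚ
frac a zero    = 0ℚ
frac a (suc b) = (+ a) ℚ./ suc b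

module _ {n : ℕ} (G : FinAbGroup n) where
  open FinAbGroup G

  mult : Carrier → List Carrier → ℕ
  mult g = count (λ x → ⌊ x ≟ g ⌋)

  _≋_ : List Carrier → List Carrier → Set
  xs ≋ ys = ∀ g → mult g xs ≡ mult g ys

  𝒟 : List Carrier → List Carrier → List Carrier
  𝒟 As Bs = concatMap (λ x → map (λ y → x - y) Bs) As

  record DisjointKSubsets (m k : ℕ) (A : Fin m → List Carrier) : Set where
    field
      noDup    : ∀ i → Unique (A i)
      size     : ∀ i → length (A i) ≡ k
      disjoint : ∀ i j → i ≢ j → ∀ x → x ∈ A i → x ∉ A j

  allExtDiffs : {m : ℕ} → (Fin m → List Carrier) → List Carrier
  allExtDiffs {m} A =
    concatMap (λ i → concatMap (λ j →
        if ⌊ i FinP.≟ j ⌋ then [] else 𝒟 (A i) (A j))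
      (Data.List.allFin m)) (Data.List.allFin m)

  nonzeroTimes : ℕ → List Carrier
  nonzeroTimes zero    = []
  nonzeroTimes (suc l) =
    filter (λ g → Relation.Nullary.¬? (g ≟ 0#)) elements
    Data.List.++ nonzeroTimes l

  IsEDF : (m k l : ℕ) → (Fin m → List Carrier) → Set
  IsEDF m k l A = DisjointKSubsets m k A × (allExtDiffs A ≋ nonzeroTimes l)

  -- Weak AMD code with sources Fin m, A(s) = A s, E(s) uniform on A(s).

  hits : {m : ℕ} → (Fin m → List Carrier) → Fin m → Carrier → Bool
  hits {m} A s g =
    Data.Bool.ListAction.any (λ s' → Data.Bool._∧_ (Data.Bool.not ⌊ s FinP.≟ s' ⌋)
                                        (Data.Bool.ListAction.any (λ y → ⌊ g ≟ y ⌋) (A s')))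
                  (Data.List.allFin m)

  winCount : {m : ℕ} → (Fin m → List Carrier) → Carrier → ℕ
  winCount {m} A Δ =
    Data.Nat.ListAction.sum (map (λ s → count (λ g → hits A s (g + Δ)) (A s)) (Data.List.allFin m))

  -- probability of winning with fixed Δ:  (1/m) Σ_s (1/k) #{g ∈ A(s) : win}
  winProbΔ : (m k : ℕ) → (Fin m → List Carrier) → Carrier → ℚ
  winProbΔ m k A Δ = frac (winCount A Δ) (k ℕ.* m)

  record Strategy : Set where
    field
      p       : Carrier → ℚ
      nonneg  : ∀ g → 0ℚ ℚ.≤ p g
      zeroAt0 : p 0# ≡ 0ℚ
      total   : sumℚ p elements ≡ 1ℚ

  -- winning probability of a strategy (Δ drawn independently of s)
  winProb : (m k : ℕ) → (Fin m → List Carrier) → Strategy → ℚ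
  winProb m k A σ = sumℚ (λ Δ → Strategy.p σ Δ ℚ.* winProbΔ m k A Δ) elements

  IsMaxSuccess : (m k : ℕ) → (Fin m → List Carrier) → ℚ → Set
  IsMaxSuccess m k A ε =
    (∀ σ → winProb m k A σ ℚ.≤ ε) × (∃[ σ ] winProb m k A σ ≡ ε)

  -- R-optimal: ε̂ = a(m-1)/(m(n-1)) with a = km
  IsROptimal : (m k : ℕ) → ℚ → Set
  IsROptimal m k ε = ε ≡ frac ((k ℕ.* m) ℕ.* (m ∸ 1)) (m ℕ.* (n ∸ 1))

  -- G-optimal: ε̂ = 1/a with a = km
  IsGOptimal : (m k : ℕ) → ℚ → Set
  IsGOptimal m k ε = ε ≡ frac 1 (k ℕ.* m)

-- Fix a shift Δ. The adversary wins on encoding g of source s exactly when g + Δ = y for some y in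
-- another set A(s'), i.e. when Δ = y − g is an external difference; disjointness makes s' unique, so
-- the number wins(Δ) of winning pairs (s, g) is the multiplicity of Δ in ⋃_{i≠j} 𝒟(A_i, A_j). These
-- multiplicities vanish at Δ = 0 and add up to m(m−1)k². A point mass on Δ wins with probability
-- wins(Δ)/(km), so G-optimality bounds every wins(Δ) by 1, and given G-optimality, R-optimality is the
-- count m(m−1)k² = n − 1. The n − 1 numbers wins(Δ), Δ ≠ 0, are then at most 1 and sum to n − 1, so all
-- equal 1: the family is an (n, m, k, 1)-EDF. Conversely, for an EDF every Δ ≠ 0 wins with probability
-- exactly 1/(km), hence so does every mixed strategy, and the same count gives R-optimality.

module Submission where

open import Defs
open import Data.Nat using (ℕ; _≤_)
open import Data.Fin using (Fin)
open import Data.List using (List)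
open import Data.Rational using (ℚ)
open import Data.Product using (_×_)
open import Function.Bundles using (_⇔_)

open import Algebra.Structures using (IsMonoid; IsAbelianGroup)
open import Data.Bool using (Bool; true; false; if_then_else_; not; _∧_)
import Data.Bool.ListAction as Bool
open import Data.Bool.Properties using (if-float; if-eta)
open import Data.Empty using (⊥-elim)
import Data.Fin.Properties as Fin
import Data.Integer as ℤ
import Data.Integer.Properties as ℤP
open import Data.List using ([]; _∷_; _++_; foldr; length; map; filter; concatMap; allFin)
import Data.List.Properties as List
open import Data.List.Membership.Propositional using (_∈_)
open import Data.List.Membership.Propositional.Properties using (∈-map⁺; ∈-allFin)
import Data.List.Relation.Unary.All as All
open import Data.List.Relation.Unary.Any using (here; there)
open import Data.List.Relation.Unary.Unique.Propositional using (Unique; _∷_)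
open import Data.List.Relation.Unary.Unique.Propositional.Properties using (allFin⁺; map⁺)
open import Data.Nat using (zero; suc; _+_; _*_; _∸_; z≤n; NonZero; >-nonZero)
open import Data.Nat.ListAction using (sum)
open import Data.Nat.ListAction.Properties using (sum-++)
import Data.Nat.Properties as ℕP
open import Data.Nat.Tactic.RingSolver using (solve-∀)
open import Data.Rational as ℚ using (0ℚ; 1ℚ)
import Data.Rational.Properties as ℚP
import Data.Rational.Unnormalised as ℚᵘ
import Data.Rational.Unnormalised.Properties as ℚᵘP
open import Data.Product using (_,_)
open import Data.Sum using (inj₁; inj₂)
open import Function using (_∘_; id)
open import Function.Bundles using (Inverse; Injection; Equivalence; mk⇔)
open import Function.Properties.Inverse using (↔⇒↣)
open import Relation.Binary.PropositionalEquality
open import Relation.Nullary using (Dec; yes; no; does; ¬_; ¬?)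
open import Relation.Nullary.Decidable using (⌊_⌋; T?; isYes≗does; dec-true; dec-false; does-⇔)

private variable
  A B : Set

⌊⌋-yes : ∀ {P : Set} (p? : Dec P) → P → ⌊ p? ⌋ ≡ true
⌊⌋-yes p? p = trans (isYes≗does p?) (dec-true p? p)

⌊⌋-no : ∀ {P : Set} (p? : Dec P) → ¬ P → ⌊ p? ⌋ ≡ false
⌊⌋-no p? ¬p = trans (isYes≗does p?) (dec-false p? ¬p)

⌊⌋-true : ∀ {P : Set} (p? : Dec P) → ⌊ p? ⌋ ≡ true → P
⌊⌋-true (yes p) _ = p

⌊⌋-⇔ : ∀ {P Q : Set} → P ⇔ Q → (p? : Dec P) (q? : Dec Q) → ⌊ p? ⌋ ≡ ⌊ q? ⌋
⌊⌋-⇔ P⇔Q p? q? = trans (isYes≗does p?) (trans (does-⇔ P⇔Q p? q?) (sym (isYes≗does q?)))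

-- Finite sums

∑ : List A → (A → ℕ) → ℕ
∑ xs f = sum (map f xs)

syntax ∑ xs (λ x → e) = ∑[ x ← xs ] e

𝟙 : Bool → ℕ
𝟙 b = if b then 1 else 0

module _ {M : Set} {_∙_ : M → M → M} {ε : M} (isMonoid : IsMonoid _≡_ _∙_ ε) where
  open IsMonoid isMonoid using (identityˡ; identityʳ)

  foldr-vanish : ∀ {f : A → M} xs → (∀ {x} → x ∈ xs → f x ≡ ε) →
                 foldr (λ x acc → f x ∙ acc) ε xs ≡ ε
  foldr-vanish []       f≡ε = refl
  foldr-vanish (x ∷ xs) f≡ε =
    trans (cong₂ _∙_ (f≡ε (here refl)) (foldr-vanish xs (f≡ε ∘ there))) (identityˡ ε)

  foldr-single : ∀ {f : A → M} {v} xs → Unique xs → v ∈ xs →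
                 (∀ {y} → y ≢ v → f y ≡ ε) → foldr (λ x acc → f x ∙ acc) ε xs ≡ f v
  foldr-single {f = f} (x ∷ xs) (x∉xs ∷ _) (here refl) f≡ε =
    trans (cong (f x ∙_) (foldr-vanish xs (λ y∈ → f≡ε (λ y≡x → All.lookup x∉xs y∈ (sym y≡x)))))
          (identityʳ (f x))
  foldr-single {f = f} (x ∷ xs) (x∉xs ∷ xs!) (there v∈) f≡ε =
    trans (cong (_∙ foldr (λ x acc → f x ∙ acc) ε xs) (f≡ε (All.lookup x∉xs v∈)))
          (trans (identityˡ (foldr (λ x acc → f x ∙ acc) ε xs)) (foldr-single xs xs! v∈ f≡ε))

∑-cong-∈ : ∀ {f g : A → ℕ} xs → (∀ {x} → x ∈ xs → f x ≡ g x) → ∑ xs f ≡ ∑ xs g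
∑-cong-∈ []       f≡g = refl
∑-cong-∈ (x ∷ xs) f≡g = cong₂ _+_ (f≡g (here refl)) (∑-cong-∈ xs (f≡g ∘ there))

∑-cong : ∀ {f g : A → ℕ} xs → (∀ x → f x ≡ g x) → ∑ xs f ≡ ∑ xs g
∑-cong xs f≡g = ∑-cong-∈ xs (λ {x} _ → f≡g x)

∑-zero : ∀ (xs : List A) → ∑[ _ ← xs ] 0 ≡ 0
∑-zero []       = refl
∑-zero (_ ∷ xs) = ∑-zero xs

∑-vanish : ∀ {f : A → ℕ} xs → (∀ {x} → x ∈ xs → f x ≡ 0) → ∑ xs f ≡ 0
∑-vanish xs f≡0 = trans (∑-cong-∈ xs f≡0) (∑-zero xs)

∑-const : ∀ (xs : List A) c → ∑[ _ ← xs ] c ≡ length xs * c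
∑-const []       c = refl
∑-const (_ ∷ xs) c = cong (c +_) (∑-const xs c)

length-∑ : ∀ (xs : List A) → length xs ≡ ∑[ _ ← xs ] 1
length-∑ []       = refl
length-∑ (_ ∷ xs) = cong suc (length-∑ xs)

∑-+ : ∀ (f g : A → ℕ) xs → ∑[ x ← xs ] (f x + g x) ≡ ∑ xs f + ∑ xs g
∑-+ f g []       = refl
∑-+ f g (x ∷ xs) = trans (cong (f x + g x +_) (∑-+ f g xs)) (interchange (f x) (g x) _ _)
  where
  interchange : ∀ a b c d → a + b + (c + d) ≡ a + c + (b + d)
  interchange = solve-∀

∑-++ : ∀ (f : A → ℕ) xs ys → ∑ (xs ++ ys) f ≡ ∑ xs f + ∑ ys f
∑-++ f xs ys = trans (cong sum (List.map-++ f xs ys)) (sum-++ (map f xs) (map f ys))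

∑-map : ∀ (f : A → ℕ) (g : B → A) xs → ∑ (map g xs) f ≡ ∑[ x ← xs ] f (g x)
∑-map f g xs = cong sum (sym (List.map-∘ xs))

∑-concatMap : ∀ (f : A → ℕ) (g : B → List A) xs →
              ∑ (concatMap g xs) f ≡ ∑[ x ← xs ] ∑ (g x) f
∑-concatMap f g []       = refl
∑-concatMap f g (x ∷ xs) =
  trans (∑-++ f (g x) (concatMap g xs)) (cong (∑ (g x) f +_) (∑-concatMap f g xs))

∑-comm : ∀ (f : A → B → ℕ) xs ys →
         ∑[ x ← xs ] ∑[ y ← ys ] f x y ≡ ∑[ y ← ys ] ∑[ x ← xs ] f x y
∑-comm f []       ys = sym (∑-zero ys)
∑-comm f (x ∷ xs) ys =
  trans (cong (∑ ys (f x) +_) (∑-comm f xs ys)) (sym (∑-+ (f x) _ ys))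

∑-if-zero : ∀ b (f : A → ℕ) xs → ∑[ x ← xs ] (if b then 0 else f x) ≡ (if b then 0 else ∑ xs f)
∑-if-zero true  f xs = ∑-zero xs
∑-if-zero false f xs = refl

∑-filter : ∀ {P : A → Set} (P? : ∀ x → Dec (P x)) (f : A → ℕ) xs →
           ∑ (filter P? xs) f ≡ ∑[ x ← xs ] (if does (P? x) then f x else 0)
∑-filter P? f []       = refl
∑-filter P? f (x ∷ xs) with does (P? x)
... | true  = cong (f x +_) (∑-filter P? f xs)
... | false = ∑-filter P? f xs

count-∑ : ∀ (p : A → Bool) xs → count p xs ≡ ∑[ x ← xs ] 𝟙 (p x)
count-∑ p xs = trans (length-∑ (filter (T? ∘ p) xs)) (∑-filter (T? ∘ p) (λ _ → 1) xs)

∑-single : ∀ {f : A → ℕ} {v} xs → Unique xs → v ∈ xs → (∀ {y} → y ≢ v → f y ≡ 0) → ∑ xs f ≡ f v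
∑-single {f = f} xs xs! v∈ f≡0 =
  trans (List.foldr-map _+_ f 0 xs) (foldr-single ℕP.+-0-isMonoid xs xs! v∈ f≡0)

∑-mono-≤ : ∀ {f g : A → ℕ} xs → (∀ x → f x ≤ g x) → ∑ xs f ≤ ∑ xs g
∑-mono-≤ []       f≤g = z≤n
∑-mono-≤ (x ∷ xs) f≤g = ℕP.+-mono-≤ (f≤g x) (∑-mono-≤ xs f≤g)

∑-squeeze : ∀ {f g : A → ℕ} xs → (∀ x → f x ≤ g x) → ∑ xs f ≡ ∑ xs g →
            ∀ {x} → x ∈ xs → f x ≡ g x
∑-squeeze {f = f} {g = g} (y ∷ ys) f≤g ∑≡ x∈ with ℕP.m≤n⇒m<n∨m≡n (f≤g y)
... | inj₁ fy<gy = ⊥-elim (ℕP.<⇒≢ (ℕP.+-mono-<-≤ fy<gy (∑-mono-≤ ys f≤g)) ∑≡)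
... | inj₂ fy≡gy with x∈
...   | here refl  = fy≡gy
...   | there x∈ys =
  ∑-squeeze ys f≤g (ℕP.+-cancelˡ-≡ (f y) _ _ (trans ∑≡ (cong (_+ ∑ ys g) (sym fy≡gy)))) x∈ys

𝟙-any : ∀ (b : A → Bool) xs → Unique xs → (∀ {x y} → b x ≡ true → b y ≡ true → x ≡ y) →
        𝟙 (Bool.any b xs) ≡ ∑[ x ← xs ] 𝟙 (b x)
𝟙-any b []       _             _        = refl
𝟙-any b (x ∷ xs) (x∉xs ∷ xs!) b-unique with b x in bx
... | true  = cong suc (sym (∑-vanish xs no-other))
  where
  no-other : ∀ {y} → y ∈ xs → 𝟙 (b y) ≡ 0
  no-other {y} y∈ with b y in by
  ... | true  = ⊥-elim (All.lookup x∉xs y∈ (b-unique bx by))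
  ... | false = refl
... | false = 𝟙-any b xs xs! b-unique

length-allFin : ∀ m → length (allFin m) ≡ m
length-allFin m = List.length-tabulate {n = m} id

module _ {m : ℕ} where

  ∑≢ : (Fin m → Fin m → ℕ) → ℕ
  ∑≢ f = ∑[ i ← allFin m ] ∑[ j ← allFin m ] (if ⌊ i Fin.≟ j ⌋ then 0 else f i j)

  syntax ∑≢ (λ i j → e) = ∑[ i ≠ j ] e

  ∑≢-cong : ∀ {f g : Fin m → Fin m → ℕ} → (∀ i j → i ≢ j → f i j ≡ g i j) → ∑≢ f ≡ ∑≢ g
  ∑≢-cong {f} {g} f≡g = ∑-cong (allFin m) λ i → ∑-cong (allFin m) λ j → off-diagonal i j
    where
    off-diagonal : ∀ i j → (if ⌊ i Fin.≟ j ⌋ then 0 else f i j) ≡ (if ⌊ i Fin.≟ j ⌋ then 0 else g i j)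
    off-diagonal i j with i Fin.≟ j
    ... | yes _   = refl
    ... | no  i≢j = f≡g i j i≢j

  ∑≢-transpose : ∀ (f : Fin m → Fin m → ℕ) → ∑[ i ≠ j ] f j i ≡ ∑≢ f
  ∑≢-transpose f =
    trans (∑-comm _ (allFin m) (allFin m))
          (∑-cong (allFin m) λ j → ∑-cong (allFin m) λ i →
            cong (λ b → if b then 0 else f j i) (⌊⌋-⇔ (mk⇔ sym sym) (i Fin.≟ j) (j Fin.≟ i)))

  ∑≢-const : ∀ c → ∑[ i ≠ j ] c ≡ m * ((m ∸ 1) * c)
  ∑≢-const c =
    trans (∑-cong (allFin m) row)
          (trans (∑-const (allFin m) ((m ∸ 1) * c)) (cong (_* ((m ∸ 1) * c)) (length-allFin m)))
    where
    diagonal : ∀ i → ∑[ j ← allFin m ] (if ⌊ i Fin.≟ j ⌋ then c else 0) ≡ c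
    diagonal i = trans (∑-single (allFin m) (allFin⁺ m) (∈-allFin i)
                          (λ j≢i → cong (λ b → if b then c else 0) (⌊⌋-no (i Fin.≟ _) (j≢i ∘ sym))))
                       (cong (λ b → if b then c else 0) (⌊⌋-yes (i Fin.≟ i) refl))
    complement : ∀ b → (if b then 0 else c) + (if b then c else 0) ≡ c
    complement true  = refl
    complement false = ℕP.+-identityʳ c
    row : ∀ i → ∑[ j ← allFin m ] (if ⌊ i Fin.≟ j ⌋ then 0 else c) ≡ (m ∸ 1) * c
    row i = begin
      X                                  ≡⟨ ℕP.m+n∸n≡m X c ⟨
      X + c ∸ c                          ≡⟨ cong (λ y → X + y ∸ c) (diagonal i) ⟨
      X + Y ∸ c                          ≡⟨ cong (_∸ c) (∑-+ _ _ (allFin m)) ⟨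
      ∑[ j ← allFin m ] ((if ⌊ i Fin.≟ j ⌋ then 0 else c) + (if ⌊ i Fin.≟ j ⌋ then c else 0)) ∸ c
                                         ≡⟨ cong (_∸ c) (∑-cong (allFin m) (λ j → complement ⌊ i Fin.≟ j ⌋)) ⟩
      ∑[ _ ← allFin m ] c ∸ c            ≡⟨ cong (_∸ c) (∑-const (allFin m) c) ⟩
      length (allFin m) * c ∸ c          ≡⟨ cong (λ l → l * c ∸ c) (length-allFin m) ⟩
      m * c ∸ c                          ≡⟨ cong (m * c ∸_) (ℕP.*-identityˡ c) ⟨
      m * c ∸ 1 * c                      ≡⟨ ℕP.*-distribʳ-∸ c m 1 ⟨
      (m ∸ 1) * c                        ∎
      where
      open ≡-Reasoning
      X Y : ℕ
      X = ∑[ j ← allFin m ] (if ⌊ i Fin.≟ j ⌋ then 0 else c)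
      Y = ∑[ j ← allFin m ] (if ⌊ i Fin.≟ j ⌋ then c else 0)

-- Rationals

sumℚ-cong : ∀ {f g : A → ℚ} xs → (∀ x → f x ≡ g x) → sumℚ f xs ≡ sumℚ g xs
sumℚ-cong []       f≡g = refl
sumℚ-cong (x ∷ xs) f≡g = cong₂ ℚ._+_ (f≡g x) (sumℚ-cong xs f≡g)

sumℚ-*ʳ : ∀ (f : A → ℚ) c xs → sumℚ (λ x → f x ℚ.* c) xs ≡ sumℚ f xs ℚ.* c
sumℚ-*ʳ f c []       = sym (ℚP.*-zeroˡ c)
sumℚ-*ʳ f c (x ∷ xs) =
  trans (cong (f x ℚ.* c ℚ.+_) (sumℚ-*ʳ f c xs)) (sym (ℚP.*-distribʳ-+ c (f x) (sumℚ f xs)))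

frac-≡⇔ : ∀ a b c d .{{_ : NonZero b}} .{{_ : NonZero d}} → frac a b ≡ frac c d ⇔ a * d ≡ c * b
frac-≡⇔ a zero    c d       {{()}}
frac-≡⇔ a (suc b) c zero    {{_}} {{()}}
frac-≡⇔ a (suc b) c (suc d) = mk⇔ cross uncross
  where
  cross : frac a (suc b) ≡ frac c (suc d) → a * suc d ≡ c * suc b
  cross eq with ℚP.fromℚᵘ-injective {ℚᵘ.mkℚᵘ (ℤ.+ a) b} {ℚᵘ.mkℚᵘ (ℤ.+ c) d} eq
  ... | ℚᵘ.*≡* ad≡cb = ℤP.+-injective (trans (ℤP.pos-* a (suc d)) (trans ad≡cb (sym (ℤP.pos-* c (suc b)))))
  uncross : a * suc d ≡ c * suc b → frac a (suc b) ≡ frac c (suc d)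
  uncross ad≡cb = ℚP.fromℚᵘ-cong {ℚᵘ.mkℚᵘ (ℤ.+ a) b} {ℚᵘ.mkℚᵘ (ℤ.+ c) d}
    (ℚᵘ.*≡* (trans (sym (ℤP.pos-* a (suc d))) (trans (cong ℤ.+_ ad≡cb) (ℤP.pos-* c (suc b)))))

1*[m*N]≡km*x*km⇔m*[x*k*k]≡N : ∀ m k x N .{{_ : NonZero m}} →
                              1 * (m * N) ≡ k * m * x * (k * m) ⇔ m * (x * (k * k)) ≡ N
1*[m*N]≡km*x*km⇔m*[x*k*k]≡N m k x N = mk⇔
  (λ eq → sym (ℕP.*-cancelˡ-≡ N _ m (trans (sym (ℕP.*-identityˡ (m * N))) (trans eq (regroup m k x)))))
  (λ eq → trans (ℕP.*-identityˡ (m * N)) (trans (cong (m *_) (sym eq)) (sym (regroup m k x))))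
  where
  regroup : ∀ m k x → k * m * x * (k * m) ≡ m * (m * (x * (k * k)))
  regroup = solve-∀

frac-≤-reflects : ∀ a b c .{{_ : NonZero b}} → frac a b ℚ.≤ frac c b → a ≤ c
frac-≤-reflects a zero    c {{()}}
frac-≤-reflects a (suc b) c ≤ with ℚᵘP.≤-respʳ-≃ (ℚP.toℚᵘ-fromℚᵘ (ℚᵘ.mkℚᵘ (ℤ.+ c) b))
                                     (ℚᵘP.≤-respˡ-≃ (ℚP.toℚᵘ-fromℚᵘ (ℚᵘ.mkℚᵘ (ℤ.+ a) b)) (ℚP.toℚᵘ-mono-≤ ≤))
... | ℚᵘ.*≤* ab≤cb = ℕP.*-cancelʳ-≤ a c (suc b)
  (ℤP.drop‿+≤+ (subst₂ ℤ._≤_ (sym (ℤP.pos-* a (suc b))) (sym (ℤP.pos-* c (suc b))) ab≤cb))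

-- The group, its external differences and the adversary's wins

module _ {n : ℕ} (G : FinAbGroup n) where
  open FinAbGroup G renaming (_+_ to _⊕_; _-_ to _⊖_)
  open IsAbelianGroup isAbelianGroup using (assoc; comm; identityʳ; inverseˡ; inverseʳ)

  x+d≡y⇔y-x≡d : ∀ x d y → x ⊕ d ≡ y ⇔ y ⊖ x ≡ d
  x+d≡y⇔y-x≡d x d y = mk⇔ subtract add
    where
    open ≡-Reasoning
    subtract : x ⊕ d ≡ y → y ⊖ x ≡ d
    subtract x+d≡y = begin
      y ⊖ x             ≡⟨ cong (_⊖ x) x+d≡y ⟨
      (x ⊕ d) ⊕ - x     ≡⟨ cong (_⊕ - x) (comm x d) ⟩
      (d ⊕ x) ⊕ - x     ≡⟨ assoc d x (- x) ⟩
      d ⊕ (x ⊖ x)       ≡⟨ cong (d ⊕_) (inverseʳ x) ⟩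
      d ⊕ 0#            ≡⟨ identityʳ d ⟩
      d                 ∎
    add : y ⊖ x ≡ d → x ⊕ d ≡ y
    add y-x≡d = begin
      x ⊕ d             ≡⟨ cong (x ⊕_) y-x≡d ⟨
      x ⊕ (y ⊖ x)       ≡⟨ comm x (y ⊖ x) ⟩
      (y ⊖ x) ⊕ x       ≡⟨ assoc y (- x) x ⟩
      y ⊕ (- x ⊕ x)     ≡⟨ cong (y ⊕_) (inverseˡ x) ⟩
      y ⊕ 0#            ≡⟨ identityʳ y ⟩
      y                 ∎

  elements-unique : Unique elements
  elements-unique = map⁺ (Injection.injective (↔⇒↣ enum)) (allFin⁺ n)

  ∈-elements : ∀ x → x ∈ elements
  ∈-elements x = subst (_∈ elements) (Inverse.strictlyInverseˡ enum x)
                       (∈-map⁺ (Inverse.to enum) (∈-allFin (Inverse.from enum x)))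

  length-elements : length elements ≡ n
  length-elements = trans (List.length-map (Inverse.to enum) (allFin n)) (length-allFin n)

  ∑-elements-single : ∀ {f : Carrier → ℕ} v → (∀ {y} → y ≢ v → f y ≡ 0) → ∑ elements f ≡ f v
  ∑-elements-single v = ∑-single elements elements-unique (∈-elements v)

  𝟙-≟-refl : ∀ x → 𝟙 ⌊ x ≟ x ⌋ ≡ 1
  𝟙-≟-refl x = cong 𝟙 (⌊⌋-yes (x ≟ x) refl)

  𝟙-≟-≢ : ∀ {x y} → x ≢ y → 𝟙 ⌊ x ≟ y ⌋ ≡ 0
  𝟙-≟-≢ {x} {y} x≢y = cong 𝟙 (⌊⌋-no (x ≟ y) x≢y)

  ∑-mult : ∀ xs → ∑[ g ← elements ] mult G g xs ≡ length xs
  ∑-mult xs = begin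
    ∑[ g ← elements ] mult G g xs                ≡⟨ ∑-cong elements (λ g → count-∑ _ xs) ⟩
    ∑[ g ← elements ] ∑[ x ← xs ] 𝟙 ⌊ x ≟ g ⌋    ≡⟨ ∑-comm _ elements xs ⟩
    ∑[ x ← xs ] ∑[ g ← elements ] 𝟙 ⌊ x ≟ g ⌋    ≡⟨ ∑-cong xs exactly-once ⟩
    ∑[ _ ← xs ] 1                                ≡⟨ length-∑ xs ⟨
    length xs                                    ∎
    where
    open ≡-Reasoning
    exactly-once : ∀ x → ∑[ g ← elements ] 𝟙 ⌊ x ≟ g ⌋ ≡ 1
    exactly-once x = trans (∑-elements-single x (λ g≢x → 𝟙-≟-≢ (g≢x ∘ sym))) (𝟙-≟-refl x)

  nonzero : Carrier → ℕ
  nonzero Δ = 𝟙 (not ⌊ Δ ≟ 0# ⌋)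

  nonzero-≢0 : ∀ {Δ} → Δ ≢ 0# → nonzero Δ ≡ 1
  nonzero-≢0 {Δ} Δ≢0 = cong (𝟙 ∘ not) (⌊⌋-no (Δ ≟ 0#) Δ≢0)

  nonzero-complement : ∀ b → 𝟙 (not b) + 𝟙 b ≡ 1
  nonzero-complement true  = refl
  nonzero-complement false = refl

  ∑-nonzero : ∑ elements nonzero ≡ n ∸ 1
  ∑-nonzero = begin
    ∑ elements nonzero                              ≡⟨ ℕP.m+n∸n≡m _ 1 ⟨
    ∑ elements nonzero + 1 ∸ 1                      ≡⟨ cong (λ z → ∑ elements nonzero + z ∸ 1) zero-once ⟨
    ∑ elements nonzero + ∑[ Δ ← elements ] 𝟙 ⌊ Δ ≟ 0# ⌋ ∸ 1
                                                    ≡⟨ cong (_∸ 1) (∑-+ nonzero _ elements) ⟨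
    ∑[ Δ ← elements ] (nonzero Δ + 𝟙 ⌊ Δ ≟ 0# ⌋) ∸ 1
                                                    ≡⟨ cong (_∸ 1) (∑-cong elements (λ Δ → nonzero-complement ⌊ Δ ≟ 0# ⌋)) ⟩
    ∑[ _ ← elements ] 1 ∸ 1                         ≡⟨ cong (_∸ 1) (length-∑ elements) ⟨
    length elements ∸ 1                             ≡⟨ cong (_∸ 1) length-elements ⟩
    n ∸ 1                                           ∎
    where
    open ≡-Reasoning
    zero-once : ∑[ Δ ← elements ] 𝟙 ⌊ Δ ≟ 0# ⌋ ≡ 1
    zero-once = trans (∑-elements-single 0# 𝟙-≟-≢) (𝟙-≟-refl 0#)

  mult-++ : ∀ g xs ys → mult G g (xs ++ ys) ≡ mult G g xs + mult G g ys
  mult-++ g xs ys =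
    trans (count-∑ _ (xs ++ ys)) (trans (∑-++ _ xs ys) (sym (cong₂ _+_ (count-∑ _ xs) (count-∑ _ ys))))

  mult-nonzeroElements : ∀ Δ → mult G Δ (filter (λ g → ¬? (g ≟ 0#)) elements) ≡ nonzero Δ
  mult-nonzeroElements Δ =
    trans (count-∑ _ (filter _ elements))
          (trans (∑-filter _ _ elements) (trans (∑-elements-single Δ off-Δ) at-Δ))
    where
    off-Δ : ∀ {y} → y ≢ Δ → (if not (does (y ≟ 0#)) then 𝟙 ⌊ y ≟ Δ ⌋ else 0) ≡ 0
    off-Δ {y} y≢Δ = trans (cong (λ z → if not (does (y ≟ 0#)) then z else 0) (𝟙-≟-≢ y≢Δ)) (if-eta _)
    at-Δ : (if not (does (Δ ≟ 0#)) then 𝟙 ⌊ Δ ≟ Δ ⌋ else 0) ≡ nonzero Δ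
    at-Δ = trans (cong (λ z → if not (does (Δ ≟ 0#)) then z else 0) (𝟙-≟-refl Δ))
                 (cong (𝟙 ∘ not) (sym (isYes≗does (Δ ≟ 0#))))

  mult-nonzeroTimes : ∀ l Δ → mult G Δ (nonzeroTimes G l) ≡ l * nonzero Δ
  mult-nonzeroTimes zero    Δ = refl
  mult-nonzeroTimes (suc l) Δ =
    trans (mult-++ Δ (filter (λ g → ¬? (g ≟ 0#)) elements) (nonzeroTimes G l))
          (cong₂ _+_ (mult-nonzeroElements Δ) (mult-nonzeroTimes l Δ))

  representations : Carrier → List Carrier → List Carrier → ℕ
  representations Δ X Y = ∑[ x ← X ] ∑[ y ← Y ] 𝟙 ⌊ (x ⊖ y) ≟ Δ ⌋

  ∑-𝒟 : ∀ (f : Carrier → ℕ) X Y → ∑ (𝒟 G X Y) f ≡ ∑[ x ← X ] ∑[ y ← Y ] f (x ⊖ y)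
  ∑-𝒟 f X Y = trans (∑-concatMap f _ X) (∑-cong X λ x → ∑-map f _ Y)

  length-𝒟 : ∀ X Y → length (𝒟 G X Y) ≡ length X * length Y
  length-𝒟 X Y = begin
    length (𝒟 G X Y)                 ≡⟨ length-∑ (𝒟 G X Y) ⟩
    ∑[ _ ← 𝒟 G X Y ] 1               ≡⟨ ∑-𝒟 _ X Y ⟩
    ∑[ _ ← X ] ∑[ _ ← Y ] 1          ≡⟨ ∑-cong X (λ _ → length-∑ Y) ⟨
    ∑[ _ ← X ] length Y              ≡⟨ ∑-const X (length Y) ⟩
    length X * length Y              ∎
    where open ≡-Reasoning

  ∑-allExtDiffs : ∀ {m} (A : Fin m → List Carrier) (f : Carrier → ℕ) →
                  ∑ (allExtDiffs G A) f ≡ ∑[ i ≠ j ] ∑ (𝒟 G (A i) (A j)) f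
  ∑-allExtDiffs {m} A f =
    trans (∑-concatMap f _ (allFin m)) (∑-cong (allFin m) λ i →
      trans (∑-concatMap f _ (allFin m)) (∑-cong (allFin m) λ j →
        if-float (λ ds → ∑ ds f) ⌊ i Fin.≟ j ⌋))

  mult-allExtDiffs : ∀ {m} (A : Fin m → List Carrier) Δ →
                     mult G Δ (allExtDiffs G A) ≡ ∑[ i ≠ j ] representations Δ (A i) (A j)
  mult-allExtDiffs A Δ =
    trans (count-∑ _ (allExtDiffs G A))
          (trans (∑-allExtDiffs A _) (∑≢-cong λ i j _ → ∑-𝒟 _ (A i) (A j)))

  any-≟-∈ : ∀ {g} ys → Bool.any (λ y → ⌊ g ≟ y ⌋) ys ≡ true → g ∈ ys
  any-≟-∈ {g} (y ∷ ys) any≡true with g ≟ y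
  ... | yes g≡y = here g≡y
  ... | no  _   = there (any-≟-∈ ys any≡true)

  sumℚ-elements-single : ∀ {f : Carrier → ℚ} v → (∀ {y} → y ≢ v → f y ≡ 0ℚ) → sumℚ f elements ≡ f v
  sumℚ-elements-single v = foldr-single ℚP.+-0-isMonoid elements elements-unique (∈-elements v)

  dirac : Carrier → Carrier → ℚ
  dirac Δ g = if ⌊ g ≟ Δ ⌋ then 1ℚ else 0ℚ

  dirac-≡ : ∀ Δ → dirac Δ Δ ≡ 1ℚ
  dirac-≡ Δ = cong (λ b → if b then 1ℚ else 0ℚ) (⌊⌋-yes (Δ ≟ Δ) refl)

  dirac-≢ : ∀ {Δ g} → g ≢ Δ → dirac Δ g ≡ 0ℚ
  dirac-≢ {Δ} {g} g≢Δ = cong (λ b → if b then 1ℚ else 0ℚ) (⌊⌋-no (g ≟ Δ) g≢Δ)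

  pointMass : ∀ Δ → Δ ≢ 0# → Strategy G
  pointMass Δ Δ≢0 = record
    { p       = dirac Δ
    ; nonneg  = nonneg
    ; zeroAt0 = dirac-≢ (Δ≢0 ∘ sym)
    ; total   = trans (sumℚ-elements-single Δ dirac-≢) (dirac-≡ Δ)
    }
    where
    nonneg : ∀ g → 0ℚ ℚ.≤ dirac Δ g
    nonneg g with ⌊ g ≟ Δ ⌋
    ... | true  = ℚP.nonNegative⁻¹ 1ℚ
    ... | false = ℚP.≤-refl

  winProb-pointMass : ∀ {m k} (A : Fin m → List Carrier) Δ (Δ≢0 : Δ ≢ 0#) →
                      winProb G m k A (pointMass Δ Δ≢0) ≡ winProbΔ G m k A Δ
  winProb-pointMass {m} {k} A Δ Δ≢0 = begin
    winProb G m k A (pointMass Δ Δ≢0) ≡⟨ sumℚ-elements-single Δ off-Δ ⟩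
    dirac Δ Δ ℚ.* w Δ                 ≡⟨ cong (ℚ._* w Δ) (dirac-≡ Δ) ⟩
    1ℚ ℚ.* w Δ                        ≡⟨ ℚP.*-identityˡ (w Δ) ⟩
    w Δ                               ∎
    where
    open ≡-Reasoning
    w : Carrier → ℚ
    w = winProbΔ G m k A
    off-Δ : ∀ {y} → y ≢ Δ → dirac Δ y ℚ.* w y ≡ 0ℚ
    off-Δ {y} y≢Δ = trans (cong (ℚ._* w y) (dirac-≢ y≢Δ)) (ℚP.*-zeroˡ (w y))

  winProb-const : ∀ {m k} (A : Fin m → List Carrier) c →
                  (∀ Δ → Δ ≢ 0# → winProbΔ G m k A Δ ≡ c) → ∀ σ → winProb G m k A σ ≡ c
  winProb-const {m} {k} A c winProbΔ≡c σ =
    trans (sumℚ-cong elements weighted)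
          (trans (sumℚ-*ʳ p c elements) (trans (cong (ℚ._* c) total) (ℚP.*-identityˡ c)))
    where
    open Strategy σ
    weighted : ∀ Δ → p Δ ℚ.* winProbΔ G m k A Δ ≡ p Δ ℚ.* c
    weighted Δ with Δ ≟ 0#
    ... | yes refl = begin
      p 0# ℚ.* winProbΔ G m k A 0# ≡⟨ cong (ℚ._* winProbΔ G m k A 0#) zeroAt0 ⟩
      0ℚ ℚ.* winProbΔ G m k A 0#   ≡⟨ ℚP.*-zeroˡ (winProbΔ G m k A 0#) ⟩
      0ℚ                           ≡⟨ ℚP.*-zeroˡ c ⟨
      0ℚ ℚ.* c                     ≡⟨ cong (ℚ._* c) zeroAt0 ⟨
      p 0# ℚ.* c                   ∎
      where open ≡-Reasoning
    ... | no  Δ≢0  = cong (p Δ ℚ.*_) (winProbΔ≡c Δ Δ≢0)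

  R-optimal⇔size : ∀ {m k ε} .{{_ : NonZero m}} .{{_ : NonZero k}} .{{_ : NonZero (n ∸ 1)}} →
                   IsGOptimal G m k ε → IsROptimal G m k ε ⇔ m * ((m ∸ 1) * (k * k)) ≡ n ∸ 1
  R-optimal⇔size {m} {k} G-opt = mk⇔
    (λ R-opt → Equivalence.to arith (Equivalence.to cross (trans (sym G-opt) R-opt)))
    (λ size → trans G-opt (Equivalence.from cross (Equivalence.from arith size)))
    where
    cross : frac 1 (k * m) ≡ frac (k * m * (m ∸ 1)) (m * (n ∸ 1)) ⇔
            1 * (m * (n ∸ 1)) ≡ k * m * (m ∸ 1) * (k * m)
    cross = frac-≡⇔ 1 (k * m) (k * m * (m ∸ 1)) (m * (n ∸ 1)) {{ℕP.m*n≢0 k m}} {{ℕP.m*n≢0 m (n ∸ 1)}}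
    arith : 1 * (m * (n ∸ 1)) ≡ k * m * (m ∸ 1) * (k * m) ⇔ m * ((m ∸ 1) * (k * k)) ≡ n ∸ 1
    arith = 1*[m*N]≡km*x*km⇔m*[x*k*k]≡N m k (m ∸ 1) (n ∸ 1)

  module _ {m k : ℕ} {A : Fin m → List Carrier} (family : DisjointKSubsets G m k A) where
    open DisjointKSubsets family

    length-allExtDiffs : length (allExtDiffs G A) ≡ m * ((m ∸ 1) * (k * k))
    length-allExtDiffs = begin
      length (allExtDiffs G A)             ≡⟨ length-∑ (allExtDiffs G A) ⟩
      ∑[ _ ← allExtDiffs G A ] 1           ≡⟨ ∑-allExtDiffs A _ ⟩
      ∑[ i ≠ j ] ∑[ _ ← 𝒟 G (A i) (A j) ] 1 ≡⟨ ∑≢-cong (λ i j _ → size² i j) ⟩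
      ∑≢ {m} (λ _ _ → k * k)               ≡⟨ ∑≢-const {m} (k * k) ⟩
      m * ((m ∸ 1) * (k * k))              ∎
      where
      open ≡-Reasoning
      size² : ∀ i j → ∑[ _ ← 𝒟 G (A i) (A j) ] 1 ≡ k * k
      size² i j = trans (sym (length-∑ (𝒟 G (A i) (A j))))
                        (trans (length-𝒟 (A i) (A j)) (cong₂ _*_ (size i) (size j)))

    representations-0 : ∀ {i j} → i ≢ j → representations 0# (A i) (A j) ≡ 0
    representations-0 {i} {j} i≢j = ∑-vanish (A i) λ {x} x∈ → ∑-vanish (A j) λ {y} y∈ →
      𝟙-≟-≢ λ x-y≡0 → disjoint i j i≢j x x∈
        (subst (_∈ A j) (trans (sym (identityʳ y)) (Equivalence.from (x+d≡y⇔y-x≡d y 0# x) x-y≡0)) y∈)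

    𝟙-hits : ∀ s g → 𝟙 (hits G A s g) ≡
             ∑[ s' ← allFin m ] (if ⌊ s Fin.≟ s' ⌋ then 0 else ∑[ y ← A s' ] 𝟙 ⌊ g ≟ y ⌋)
    𝟙-hits s g = trans (𝟙-any _ (allFin m) (allFin⁺ m) at-most-one-source) (∑-cong (allFin m) per-source)
      where
      ∧-elimʳ : ∀ {a b} → a ∧ b ≡ true → b ≡ true
      ∧-elimʳ {true} b≡true = b≡true
      at-most-one-source : ∀ {s₁ s₂} →
        not ⌊ s Fin.≟ s₁ ⌋ ∧ Bool.any (λ y → ⌊ g ≟ y ⌋) (A s₁) ≡ true →
        not ⌊ s Fin.≟ s₂ ⌋ ∧ Bool.any (λ y → ⌊ g ≟ y ⌋) (A s₂) ≡ true → s₁ ≡ s₂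
      at-most-one-source {s₁} {s₂} g∈₁ g∈₂ with s₁ Fin.≟ s₂
      ... | yes s₁≡s₂ = s₁≡s₂
      ... | no  s₁≢s₂ =
        ⊥-elim (disjoint s₁ s₂ s₁≢s₂ g (any-≟-∈ (A s₁) (∧-elimʳ g∈₁))
                                       (any-≟-∈ (A s₂) (∧-elimʳ g∈₂)))
      per-source : ∀ s' → 𝟙 (not ⌊ s Fin.≟ s' ⌋ ∧ Bool.any (λ y → ⌊ g ≟ y ⌋) (A s')) ≡
                          (if ⌊ s Fin.≟ s' ⌋ then 0 else ∑[ y ← A s' ] 𝟙 ⌊ g ≟ y ⌋)
      per-source s' with ⌊ s Fin.≟ s' ⌋
      ... | true  = refl
      ... | false = 𝟙-any _ (A s') (noDup s')
                      (λ e₁ e₂ → trans (sym (⌊⌋-true (g ≟ _) e₁)) (⌊⌋-true (g ≟ _) e₂))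

    winCount≡mult-allExtDiffs : ∀ Δ → winCount G A Δ ≡ mult G Δ (allExtDiffs G A)
    winCount≡mult-allExtDiffs Δ = begin
      winCount G A Δ
        ≡⟨ ∑-cong (allFin m) (λ s → count-∑ _ (A s)) ⟩
      ∑[ s ← allFin m ] ∑[ g ← A s ] 𝟙 (hits G A s (g ⊕ Δ))
        ≡⟨ ∑-cong (allFin m) (λ s → ∑-cong (A s) (λ g → 𝟙-hits s (g ⊕ Δ))) ⟩
      ∑[ s ← allFin m ] ∑[ g ← A s ] ∑[ s' ← allFin m ]
        (if ⌊ s Fin.≟ s' ⌋ then 0 else ∑[ y ← A s' ] 𝟙 ⌊ (g ⊕ Δ) ≟ y ⌋)
        ≡⟨ ∑-cong (allFin m) (λ s → trans (∑-comm _ (A s) (allFin m))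
                                          (∑-cong (allFin m) λ s' → ∑-if-zero ⌊ s Fin.≟ s' ⌋ _ (A s))) ⟩
      ∑[ s ≠ s' ] ∑[ g ← A s ] ∑[ y ← A s' ] 𝟙 ⌊ (g ⊕ Δ) ≟ y ⌋
        ≡⟨ ∑≢-cong (λ s s' _ → trans (∑-comm _ (A s) (A s')) (∑-cong (A s') λ y → ∑-cong (A s) λ g →
             cong 𝟙 (⌊⌋-⇔ (x+d≡y⇔y-x≡d g Δ y) ((g ⊕ Δ) ≟ y) ((y ⊖ g) ≟ Δ)))) ⟩
      ∑[ s ≠ s' ] representations Δ (A s') (A s)
        ≡⟨ ∑≢-transpose (λ i j → representations Δ (A i) (A j)) ⟩
      ∑[ i ≠ j ] representations Δ (A i) (A j)
        ≡⟨ mult-allExtDiffs A Δ ⟨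
      mult G Δ (allExtDiffs G A)
        ∎
      where open ≡-Reasoning

    winCount-0 : winCount G A 0# ≡ 0
    winCount-0 = begin
      winCount G A 0#                           ≡⟨ winCount≡mult-allExtDiffs 0# ⟩
      mult G 0# (allExtDiffs G A)               ≡⟨ mult-allExtDiffs A 0# ⟩
      ∑[ i ≠ j ] representations 0# (A i) (A j) ≡⟨ ∑≢-cong (λ i j → representations-0) ⟩
      ∑≢ {m} (λ _ _ → 0)                        ≡⟨ ∑≢-const {m} 0 ⟩
      m * ((m ∸ 1) * 0)                         ≡⟨ cong (m *_) (ℕP.*-zeroʳ (m ∸ 1)) ⟩
      m * 0                                     ≡⟨ ℕP.*-zeroʳ m ⟩
      0                                         ∎
      where open ≡-Reasoning

    ∑-winCount : ∑ elements (winCount G A) ≡ m * ((m ∸ 1) * (k * k))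
    ∑-winCount = trans (∑-cong elements winCount≡mult-allExtDiffs)
                       (trans (∑-mult (allExtDiffs G A)) length-allExtDiffs)

    isEDF⇔winCount≡nonzero : IsEDF G m k 1 A ⇔ (∀ Δ → winCount G A Δ ≡ nonzero Δ)
    isEDF⇔winCount≡nonzero = mk⇔
      (λ (_ , multiplicities) Δ →
        trans (winCount≡mult-allExtDiffs Δ) (trans (multiplicities Δ) (nonzeroTimes₁ Δ)))
      (λ wins → family , λ Δ →
        trans (sym (winCount≡mult-allExtDiffs Δ)) (trans (wins Δ) (sym (nonzeroTimes₁ Δ))))
      where
      nonzeroTimes₁ : ∀ Δ → mult G Δ (nonzeroTimes G 1) ≡ nonzero Δ
      nonzeroTimes₁ Δ = trans (mult-nonzeroTimes 1 Δ) (ℕP.*-identityˡ (nonzero Δ))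

    winCount≤nonzero : ∀ {ε} .{{_ : NonZero (k * m)}} → (∀ σ → winProb G m k A σ ℚ.≤ ε) →
                       IsGOptimal G m k ε → ∀ Δ → winCount G A Δ ≤ nonzero Δ
    winCount≤nonzero bound G-opt Δ with Δ ≟ 0#
    ... | yes refl = ℕP.≤-reflexive winCount-0
    ... | no  Δ≢0  = frac-≤-reflects (winCount G A Δ) (k * m) 1
      (subst₂ ℚ._≤_ (winProb-pointMass {m} {k} A Δ Δ≢0) G-opt (bound (pointMass Δ Δ≢0)))

    isEDF⇒winProb≡ : IsEDF G m k 1 A → ∀ σ → winProb G m k A σ ≡ frac 1 (k * m)
    isEDF⇒winProb≡ edf = winProb-const {m} {k} A _ λ Δ Δ≢0 →
      cong (λ w → frac w (k * m)) (trans (Equivalence.to isEDF⇔winCount≡nonzero edf Δ) (nonzero-≢0 Δ≢0))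

mainTheorem12 : ∀ {n : ℕ} (G : FinAbGroup n) (m k : ℕ) →
    2 ≤ n → 2 ≤ m → 1 ≤ k →
    (A : Fin m → List (FinAbGroup.Carrier G)) →
    DisjointKSubsets G m k A →
    (ε : ℚ) → IsMaxSuccess G m k A ε →
    ((IsROptimal G m k ε × IsGOptimal G m k ε) ⇔ IsEDF G m k 1 A)
mainTheorem12 {n} G m k 2≤n 2≤m 1≤k A family ε (ε-bound , σ , winProb-σ≡ε) =
  mk⇔ optimal⇒EDF EDF⇒optimal
  where
  open FinAbGroup G using (elements)
  instance
    k≢0 : NonZero k
    k≢0 = >-nonZero 1≤k
    m≢0 : NonZero m
    m≢0 = >-nonZero (ℕP.≤-trans (ℕP.n≤1+n 1) 2≤m)
    n-1≢0 : NonZero (n ∸ 1)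
    n-1≢0 = >-nonZero (ℕP.∸-monoˡ-≤ 1 2≤n)
    km≢0 : NonZero (k * m)
    km≢0 = ℕP.m*n≢0 k m

  optimal⇒EDF : IsROptimal G m k ε × IsGOptimal G m k ε → IsEDF G m k 1 A
  optimal⇒EDF (R-opt , G-opt) = Equivalence.from (isEDF⇔winCount≡nonzero G family) λ Δ →
    ∑-squeeze elements (winCount≤nonzero G family ε-bound G-opt) ∑wins≡∑nonzero (∈-elements G Δ)
    where
    ∑wins≡∑nonzero : ∑ elements (winCount G A) ≡ ∑ elements (nonzero G)
    ∑wins≡∑nonzero = trans (∑-winCount G family)
                           (trans (Equivalence.to (R-optimal⇔size G G-opt) R-opt) (sym (∑-nonzero G)))

  EDF⇒optimal : IsEDF G m k 1 A → IsROptimal G m k ε × IsGOptimal G m k ε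
  EDF⇒optimal edf = Equivalence.from (R-optimal⇔size G G-opt) size , G-opt
    where
    G-opt : IsGOptimal G m k ε
    G-opt = trans (sym winProb-σ≡ε) (isEDF⇒winProb≡ G family edf σ)
    size : m * ((m ∸ 1) * (k * k)) ≡ n ∸ 1
    size = trans (sym (∑-winCount G family))
                 (trans (∑-cong elements (Equivalence.to (isEDF⇔winCount≡nonzero G family) edf)) (∑-nonzero G))
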